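{- Let $n$ be even and let $A$ be an abelian group of order $n$ that is not an elementary abelian $2$-group. Let $G=D(A)=\langle x, A\mid x^2=1,\ xax=a^{ -1}\ \forall a\in A\rangle$ act on the set of left cosets of $H=\langle x\rangle$ (so $G\le\mathrm{Sym}(n)$). Let $d\in\mathrm{Der}(G)$ and $D=\{d,d^{ -1}\}$. Then $\alpha(\mathrm{Cay}(G,\mathrm{Der}(G)\setminus D))\in\{2,4,6\}$; more precisely, it equals $6$ if and only if $d\in A$ and $o(d)=3$; it equals $4$ if and only if $o(d)\neq 3$ and $d=a^2$ for some $a\in A$; and it equals $2$ otherwise.
   Context: $o(d)$ is the order of $d$. A derangement is an element of $G$ fixing no coset; $\mathrm{Der}(G)$ is the set of derangements. For inverse-closed $S\subseteq G$ not containing the identity, $\mathrm{Cay}(G,S)$ is the graph on $G$ with $g,h$ adjacent iff $g^{ -1}h\in S$; $\alpha$ denotes independence number. -}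

module Defs where

open import Data.Nat using (ℕ; zero; suc; _<_; _≤_)
open import Data.Fin using (Fin)
open import Data.Bool using (Bool; true; false; _xor_; if_then_else_)
open import Data.Product using (Σ; _×_; _,_; ∃)
open import Data.Sum using (_⊎_)
open import Data.List using (List; length)
open import Data.List.Membership.Propositional using (_∈_)
open import Data.List.Relation.Unary.Unique.Propositional using (Unique)
open import Relation.Binary.PropositionalEquality using (_≡_; _≢_)
open import Relation.Nullary using (¬_)

-- Element (b , a) stands for x^b a
-- (b = false: a ∈ A; b = true: x a).
module DA {n : ℕ} (_∙_ : Fin n → Fin n → Fin n) (ε : Fin n) (_⁻¹ : Fin n → Fin n) where

  G : Set
  G = Bool × Fin n

  -- (x^i a)(x^j b) = x^(i+j) a^((-1)^j) b, using a x = x a⁻¹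
  _·_ : G → G → G
  (i , a) · (j , b) = (i xor j) , ((if j then a ⁻¹ else a) ∙ b)

  e : G
  e = false , ε

  -- (a)⁻¹ = a⁻¹ ; (x a)⁻¹ = a⁻¹ x = x a
  inv : G → G
  inv (false , a) = false , (a ⁻¹)
  inv (true , a) = true , a

  ι : Fin n → G
  ι a = false , a

  xg : G
  xg = true , ε

  InH : G → Set
  InH h = (h ≡ e) ⊎ (h ≡ xg)

  -- g fixes the left coset kH  iff  g k H = k H  iff  g k = k h for some h ∈ H
  FixesCoset : G → G → Set
  FixesCoset g k = Σ G λ h → InH h × (g · k ≡ k · h)

  Der : G → Set
  Der g = ∀ k → ¬ FixesCoset g k

  _^_ : G → ℕ → G
  g ^ zero = e
  g ^ suc m = g · (g ^ m)

  HasOrder : G → ℕ → Set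
  HasOrder g k = (0 < k) × (g ^ k ≡ e) × (∀ m → 0 < m → m < k → g ^ m ≢ e)

  InS : G → G → Set
  InS d g = Der g × (g ≢ d) × (g ≢ inv d)

  -- Cay(G,S): g ~ h iff g⁻¹h ∈ S.  Independent set = duplicate-free list
  -- of vertices with no two adjacent.
  Independent : (G → Set) → List G → Set
  Independent S L = Unique L × (∀ {g h} → g ∈ L → h ∈ L → ¬ S (inv g · h))

  IsIndependenceNumber : (G → Set) → ℕ → Set
  IsIndependenceNumber S k =
    (Σ (List G) λ L → Independent S L × (length L ≡ k)) ×
    (∀ L → Independent S L → length L ≤ k)

-- Write the elements of D(A) as u and xu (u ∈ A).  For g = xⁱu and h = xʲv the quotient g⁻¹h
-- is u⁻¹v ∈ A when i = j and x(uv) otherwise, while the non-derangements are 1 and the xb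
-- with b a square.  So for a rotation d an independent set is R ∪ xF with R, F ⊆ A, all
-- quotients inside R and inside F in {1, d, d⁻¹}, and all products uv (u ∈ R, v ∈ F)
-- squares.  A set with quotients in {1, d, d⁻¹} has at most 3 points, and at most 2 unless
-- d³ = 1; the bounds 6 and 4 are attained by R = F = {1, d, d⁻¹} and {1, d}, which consist
-- of squares.  If d is not a square, two points of R and one of F would make d^{±1} a square,
-- which leaves room for only 2 points.  For a reflection d the quotients are trivial, so α = 2.

module Submission where

open import Defs
open import Data.Nat using (ℕ; suc; _+_; _≤_; _<_; z≤n; s≤s)
open import Data.Nat.Properties using (+-mono-≤; +-identityʳ; +-suc)
open import Data.Nat.Divisibility using (_∣_)
open import Data.Fin using (Fin) renaming (_≟_ to _≟ᶠ_)
open import Data.Fin.Properties using (any?)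
open import Data.Bool using (Bool; true; false) renaming (_≟_ to _≟ᵇ_)
open import Data.Product using (Σ; ∃; _×_; _,_; proj₁; proj₂)
open import Data.Product.Properties using (≡-dec)
open import Data.Sum using (_⊎_; inj₁; inj₂)
open import Data.Empty using (⊥; ⊥-elim)
open import Data.List using (List; []; _∷_; length; map; _++_)
open import Data.List.Membership.Propositional using (_∈_)
open import Data.List.Membership.Propositional.Properties using (∈-map⁻; ∈-++⁻)
open import Data.List.Relation.Unary.Any using (here; there)
open import Data.List.Relation.Unary.All as All using (All; []; _∷_)
open import Data.List.Relation.Unary.AllPairs using (AllPairs; []; _∷_)
open import Data.List.Relation.Unary.Unique.Propositional using (Unique)
open import Data.List.Relation.Unary.Unique.Propositional.Properties using (map⁺; ++⁺)
open import Function using (_∘_)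
open import Level using (_⊔_)
open import Function.Bundles using (_⇔_; mk⇔; Equivalence)
open import Relation.Binary.PropositionalEquality
open import Relation.Nullary using (¬_; Dec; yes; no)
open import Relation.Nullary.Decidable using (decidable-stable)
open import Algebra.Bundles using (AbelianGroup)
open import Algebra.Structures using (IsGroup; IsAbelianGroup)
import Algebra.Properties.AbelianGroup as AbelianGroupProperties
import Algebra.Properties.CommutativeSemigroup as CommutativeSemigroupProperties

pattern ∈₀ = here refl
pattern ∈₁ = there ∈₀
pattern ∈₂ = there ∈₁
pattern ∈₃ = there ∈₂

pigeonhole₂ : ∀ {ℓ} {A : Set ℓ} {p q x y z : A} →
  (x ≡ p ⊎ x ≡ q) → (y ≡ p ⊎ y ≡ q) → (z ≡ p ⊎ z ≡ q) → x ≢ y → x ≢ z → y ≢ z → ⊥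
pigeonhole₂ (inj₁ x≡p) (inj₁ y≡p) _ x≢y _ _ = x≢y (trans x≡p (sym y≡p))
pigeonhole₂ (inj₂ x≡q) (inj₂ y≡q) _ x≢y _ _ = x≢y (trans x≡q (sym y≡q))
pigeonhole₂ (inj₁ x≡p) (inj₂ _) (inj₁ z≡p) _ x≢z _ = x≢z (trans x≡p (sym z≡p))
pigeonhole₂ (inj₁ _) (inj₂ y≡q) (inj₂ z≡q) _ _ y≢z = y≢z (trans y≡q (sym z≡q))
pigeonhole₂ (inj₂ _) (inj₁ y≡p) (inj₁ z≡p) _ _ y≢z = y≢z (trans y≡p (sym z≡p))
pigeonhole₂ (inj₂ x≡q) (inj₁ _) (inj₂ z≡q) _ x≢z _ = x≢z (trans x≡q (sym z≡q))

length+length≤2 : ∀ {ℓ} {A : Set ℓ} (xs ys : List A) →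
  length xs ≤ 2 → length ys ≤ 2 →
  (∀ {y} → y ∈ ys → length xs ≤ 1) → (∀ {x} → x ∈ xs → length ys ≤ 1) →
  length xs + length ys ≤ 2
length+length≤2 [] ys _ ys≤2 _ _ = ys≤2
length+length≤2 (x ∷ xs) [] xs≤2 _ _ _ = subst (_≤ 2) (sym (+-identityʳ _)) xs≤2
length+length≤2 (x ∷ xs) (y ∷ ys) _ _ xs≤1 ys≤1 = +-mono-≤ (xs≤1 ∈₀) (ys≤1 ∈₀)

module _ {ℓ} {P : Set ℓ} {k : ℕ} where

  ⇔-witnessed : P → (k ≡ k) ⇔ P
  ⇔-witnessed p = mk⇔ (λ _ → p) (λ _ → refl)

  ⇔-refuted : ∀ {m} → k ≢ m → ¬ P → (k ≡ m) ⇔ P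
  ⇔-refuted k≢m ¬p = mk⇔ (⊥-elim ∘ k≢m) (⊥-elim ∘ ¬p)

  ≡2⇔neither : ∀ {Q : Set ℓ} → (k ≡ 2 ⊎ k ≡ 4 ⊎ k ≡ 6) →
    (k ≡ 6) ⇔ P → (k ≡ 4) ⇔ Q → (k ≡ 2) ⇔ (¬ P × ¬ Q)
  ≡2⇔neither {Q} range six four = mk⇔ only-two (neither-two range)
    where
      only-two : k ≡ 2 → ¬ P × ¬ Q
      only-two refl = (λ p → 2≢6 (Equivalence.from six p)) , (λ q → 2≢4 (Equivalence.from four q))
        where
          2≢6 : 2 ≢ 6
          2≢6 ()
          2≢4 : 2 ≢ 4
          2≢4 ()
      neither-two : (k ≡ 2 ⊎ k ≡ 4 ⊎ k ≡ 6) → ¬ P × ¬ Q → k ≡ 2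
      neither-two (inj₁ k≡2) _ = k≡2
      neither-two (inj₂ (inj₁ k≡4)) (_ , ¬q) = ⊥-elim (¬q (Equivalence.to four k≡4))
      neither-two (inj₂ (inj₂ k≡6)) (¬p , _) = ⊥-elim (¬p (Equivalence.to six k≡6))

module AbelianGroupSquares {ℓ} {A : Set ℓ} {_∙_ : A → A → A} {ε : A} {_⁻¹ : A → A}
                           (isAbelianGroup : IsAbelianGroup _≡_ _∙_ ε _⁻¹) where

  private
    abelianGroup : AbelianGroup ℓ ℓ
    abelianGroup = record { isAbelianGroup = isAbelianGroup }

  open IsAbelianGroup isAbelianGroup using (identityˡ; identityʳ; inverseˡ; inverseʳ; assoc; comm)
  open IsGroup (IsAbelianGroup.isGroup isAbelianGroup) public using (_\\_)
  open AbelianGroupProperties abelianGroup public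
    using (⁻¹-involutive; ⁻¹-anti-homo-∙; ⁻¹-anti-homo-\\; ε⁻¹≈ε; ∙-cancelˡ;
           identityˡ-unique; identityʳ-unique; inverseʳ-unique; x≈z//y)
  open CommutativeSemigroupProperties (AbelianGroup.commutativeSemigroup abelianGroup)
    using (interchange)

  IsSquare : A → Set ℓ
  IsSquare z = Σ A λ c → z ≡ c ∙ c

  cube : A → A
  cube x = x ∙ (x ∙ (x ∙ ε))

  OneStep : A → A → Set ℓ
  OneStep a z = z ≡ a ⊎ z ≡ a ⁻¹

  Near : A → A → Set ℓ
  Near a z = z ≡ ε ⊎ OneStep a z

  Diffs : ∀ {ℓ′} → (A → Set ℓ′) → List A → Set (ℓ ⊔ ℓ′)
  Diffs T xs = ∀ {u v} → u ∈ xs → v ∈ xs → T (u \\ v)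

  ⁻¹≡ε⇒≡ε : ∀ {x} → x ⁻¹ ≡ ε → x ≡ ε
  ⁻¹≡ε⇒≡ε {x} eq = begin
    x         ≡⟨ sym (⁻¹-involutive x) ⟩
    (x ⁻¹) ⁻¹ ≡⟨ cong _⁻¹ eq ⟩
    ε ⁻¹      ≡⟨ ε⁻¹≈ε ⟩
    ε         ∎
    where open ≡-Reasoning

  ε\\x≡x : ∀ x → ε \\ x ≡ x
  ε\\x≡x x = trans (cong (_∙ x) ε⁻¹≈ε) (identityˡ x)

  \\≡ε⇒≡ : ∀ {u v} → u \\ v ≡ ε → u ≡ v
  \\≡ε⇒≡ {u} {v} eq = sym (∙-cancelˡ (u ⁻¹) v u (trans eq (sym (inverseˡ u))))

  \\-injectiveʳ : ∀ {u v w} → u \\ v ≡ u \\ w → v ≡ w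
  \\-injectiveʳ {u} {v} {w} = ∙-cancelˡ (u ⁻¹) v w

  \\-cancelˡ : ∀ x u v → (x ∙ u) \\ (x ∙ v) ≡ u \\ v
  \\-cancelˡ x u v = begin
    ((x ∙ u) ⁻¹) ∙ (x ∙ v)          ≡⟨ cong (_∙ (x ∙ v)) (⁻¹-anti-homo-∙ x u) ⟩
    ((u ⁻¹) ∙ (x ⁻¹)) ∙ (x ∙ v)     ≡⟨ assoc (u ⁻¹) (x ⁻¹) (x ∙ v) ⟩
    (u ⁻¹) ∙ ((x ⁻¹) ∙ (x ∙ v))     ≡⟨ cong ((u ⁻¹) ∙_) (sym (assoc (x ⁻¹) x v)) ⟩
    (u ⁻¹) ∙ (((x ⁻¹) ∙ x) ∙ v)     ≡⟨ cong (λ y → (u ⁻¹) ∙ (y ∙ v)) (inverseˡ x) ⟩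
    (u ⁻¹) ∙ (ε ∙ v)                ≡⟨ cong ((u ⁻¹) ∙_) (identityˡ v) ⟩
    (u ⁻¹) ∙ v                      ∎
    where open ≡-Reasoning

  \\-cancelʳ : ∀ x u v → (u ∙ x) \\ (v ∙ x) ≡ u \\ v
  \\-cancelʳ x u v = trans (cong₂ _\\_ (comm u x) (comm v x)) (\\-cancelˡ x u v)

  \\-transitive : ∀ u v w → (u \\ v) \\ (u \\ w) ≡ v \\ w
  \\-transitive u = \\-cancelˡ (u ⁻¹)

  ε-isSquare : IsSquare ε
  ε-isSquare = ε , sym (identityʳ ε)

  ∙-isSquare : ∀ {x y} → IsSquare x → IsSquare y → IsSquare (x ∙ y)
  ∙-isSquare (c , refl) (d , refl) = c ∙ d , interchange c c d d

  ⁻¹-isSquare : ∀ {x} → IsSquare x → IsSquare (x ⁻¹)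
  ⁻¹-isSquare (c , refl) = c ⁻¹ , ⁻¹-anti-homo-∙ c c

  isSquare-⁻¹ : ∀ {x} → IsSquare (x ⁻¹) → IsSquare x
  isSquare-⁻¹ {x} sq = subst IsSquare (⁻¹-involutive x) (⁻¹-isSquare sq)

  \\-isSquare : ∀ {x y} → IsSquare x → IsSquare y → IsSquare (x \\ y)
  \\-isSquare sx sy = ∙-isSquare (⁻¹-isSquare sx) sy

  ∙c≡c⁻¹⇒isSquare : ∀ {x c} → x ∙ c ≡ c ⁻¹ → IsSquare x
  ∙c≡c⁻¹⇒isSquare {x} {c} eq = c ⁻¹ , x≈z//y x c (c ⁻¹) eq

  x∙x≡x⁻¹⇒cube≡ε : ∀ {x} → x ∙ x ≡ x ⁻¹ → cube x ≡ ε
  x∙x≡x⁻¹⇒cube≡ε {x} eq = begin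
    x ∙ (x ∙ (x ∙ ε)) ≡⟨ cong (λ y → x ∙ (x ∙ y)) (identityʳ x) ⟩
    x ∙ (x ∙ x)       ≡⟨ cong (x ∙_) eq ⟩
    x ∙ (x ⁻¹)        ≡⟨ inverseʳ x ⟩
    ε                 ∎
    where open ≡-Reasoning

  cube≡ε⇒x∙x≡x⁻¹ : ∀ {x} → cube x ≡ ε → x ∙ x ≡ x ⁻¹
  cube≡ε⇒x∙x≡x⁻¹ {x} eq =
    inverseʳ-unique x (x ∙ x) (trans (cong (λ y → x ∙ (x ∙ y)) (sym (identityʳ x))) eq)

  x∙x≡x⁻¹⇒x⁻¹∙x⁻¹≡x : ∀ {x} → x ∙ x ≡ x ⁻¹ → (x ⁻¹) ∙ (x ⁻¹) ≡ x
  x∙x≡x⁻¹⇒x⁻¹∙x⁻¹≡x {x} eq = trans (sym (⁻¹-anti-homo-∙ x x)) (trans (cong _⁻¹ eq) (⁻¹-involutive x))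

  x⁻¹∙x⁻¹≡x⇒x∙x≡x⁻¹ : ∀ {x} → (x ⁻¹) ∙ (x ⁻¹) ≡ x → x ∙ x ≡ x ⁻¹
  x⁻¹∙x⁻¹≡x⇒x∙x≡x⁻¹ {x} eq = begin
    x ∙ x                   ≡⟨ sym (⁻¹-involutive (x ∙ x)) ⟩
    ((x ∙ x) ⁻¹) ⁻¹         ≡⟨ cong _⁻¹ (⁻¹-anti-homo-∙ x x) ⟩
    ((x ⁻¹) ∙ (x ⁻¹)) ⁻¹    ≡⟨ cong _⁻¹ eq ⟩
    x ⁻¹                    ∎
    where open ≡-Reasoning

  near-⁻¹ : ∀ {a z} → Near a z → Near a (z ⁻¹)
  near-⁻¹ (inj₁ refl) = inj₁ ε⁻¹≈ε
  near-⁻¹ (inj₂ (inj₁ refl)) = inj₂ (inj₂ refl)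
  near-⁻¹ (inj₂ (inj₂ refl)) = inj₂ (inj₁ (⁻¹-involutive _))

  near-distinct : ∀ {a u v} → u ≢ v → Near a (u \\ v) → OneStep a (u \\ v)
  near-distinct u≢v (inj₁ u\\v≡ε) = ⊥-elim (u≢v (\\≡ε⇒≡ u\\v≡ε))
  near-distinct _ (inj₂ step) = step

  near-isSquare : ∀ {a z} → ¬ IsSquare a → Near a z → IsSquare z → z ≡ ε
  near-isSquare _ (inj₁ z≡ε) _ = z≡ε
  near-isSquare ¬sq (inj₂ (inj₁ refl)) sq = ⊥-elim (¬sq sq)
  near-isSquare ¬sq (inj₂ (inj₂ refl)) sq = ⊥-elim (¬sq (isSquare-⁻¹ sq))

  -- x \\ y is a⁻² or a², and either being a or a⁻¹ forces a = ε or a³ = ε.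
  no-step-between-steps : ∀ {a x y} → a ≢ ε → cube a ≢ ε →
    OneStep a x → OneStep a y → x ≢ y → ¬ OneStep a (x \\ y)
  no-step-between-steps _ _ (inj₁ refl) (inj₁ refl) x≢y _ = x≢y refl
  no-step-between-steps _ _ (inj₂ refl) (inj₂ refl) x≢y _ = x≢y refl
  no-step-between-steps _ cube≢ε (inj₁ refl) (inj₂ refl) _ (inj₁ eq) =
    cube≢ε (x∙x≡x⁻¹⇒cube≡ε (x⁻¹∙x⁻¹≡x⇒x∙x≡x⁻¹ eq))
  no-step-between-steps a≢ε _ (inj₁ refl) (inj₂ refl) _ (inj₂ eq) =
    a≢ε (⁻¹≡ε⇒≡ε (identityʳ-unique _ _ eq))
  no-step-between-steps {a} a≢ε cube≢ε (inj₂ refl) (inj₁ refl) _ step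
    with subst (OneStep a) (cong (_∙ a) (⁻¹-involutive a)) step
  ... | inj₁ eq = a≢ε (identityʳ-unique a a eq)
  ... | inj₂ eq = cube≢ε (x∙x≡x⁻¹⇒cube≡ε eq)

  diffs-from-pairs : ∀ {ℓ′} {T : A → Set ℓ′} {xs} → T ε → (∀ {z} → T z → T (z ⁻¹)) →
    AllPairs (λ u v → T (u \\ v)) xs → Diffs T xs
  diffs-from-pairs {T = T} Tε _ (_ ∷ _) ∈₀ ∈₀ = subst T (sym (inverseˡ _)) Tε
  diffs-from-pairs _ _ (Tu ∷ _) ∈₀ (there v∈) = All.lookup Tu v∈
  diffs-from-pairs {T = T} _ T⁻¹ (Tv ∷ _) (there u∈) ∈₀ =
    subst T (⁻¹-anti-homo-\\ _ _) (T⁻¹ (All.lookup Tv u∈))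
  diffs-from-pairs Tε T⁻¹ (_ ∷ pairs) (there u∈) (there v∈) = diffs-from-pairs Tε T⁻¹ pairs u∈ v∈

  length≤1 : ∀ {xs} → Unique xs → Diffs (_≡ ε) xs → length xs ≤ 1
  length≤1 {[]} _ _ = z≤n
  length≤1 {_ ∷ []} _ _ = s≤s z≤n
  length≤1 {_ ∷ _ ∷ _} ((u₀≢u₁ ∷ _) ∷ _) diffs = ⊥-elim (u₀≢u₁ (\\≡ε⇒≡ (diffs ∈₀ ∈₁)))

  length≤3 : ∀ {a xs} → Unique xs → Diffs (Near a) xs → length xs ≤ 3
  length≤3 {xs = []} _ _ = z≤n
  length≤3 {xs = _ ∷ []} _ _ = s≤s z≤n
  length≤3 {xs = _ ∷ _ ∷ []} _ _ = s≤s (s≤s z≤n)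
  length≤3 {xs = _ ∷ _ ∷ _ ∷ []} _ _ = s≤s (s≤s (s≤s z≤n))
  length≤3 {xs = _ ∷ _ ∷ _ ∷ _ ∷ _}
    ((u₀≢u₁ ∷ u₀≢u₂ ∷ u₀≢u₃ ∷ _) ∷ (u₁≢u₂ ∷ u₁≢u₃ ∷ _) ∷ (u₂≢u₃ ∷ _) ∷ _) diffs =
    ⊥-elim (pigeonhole₂
      (near-distinct u₀≢u₁ (diffs ∈₀ ∈₁)) (near-distinct u₀≢u₂ (diffs ∈₀ ∈₂))
      (near-distinct u₀≢u₃ (diffs ∈₀ ∈₃))
      (u₁≢u₂ ∘ \\-injectiveʳ) (u₁≢u₃ ∘ \\-injectiveʳ) (u₂≢u₃ ∘ \\-injectiveʳ))

  length≤2 : ∀ {a xs} → a ≢ ε → cube a ≢ ε → Unique xs → Diffs (Near a) xs → length xs ≤ 2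
  length≤2 {xs = []} _ _ _ _ = z≤n
  length≤2 {xs = _ ∷ []} _ _ _ _ = s≤s z≤n
  length≤2 {xs = _ ∷ _ ∷ []} _ _ _ _ = s≤s (s≤s z≤n)
  length≤2 {a} {u₀ ∷ u₁ ∷ u₂ ∷ _} a≢ε cube≢ε ((u₀≢u₁ ∷ u₀≢u₂ ∷ _) ∷ (u₁≢u₂ ∷ _) ∷ _) diffs =
    ⊥-elim (no-step-between-steps a≢ε cube≢ε
      (near-distinct u₀≢u₁ (diffs ∈₀ ∈₁)) (near-distinct u₀≢u₂ (diffs ∈₀ ∈₂))
      (u₁≢u₂ ∘ \\-injectiveʳ)
      (subst (OneStep a) (sym (\\-transitive u₀ u₁ u₂)) (near-distinct u₁≢u₂ (diffs ∈₁ ∈₂))))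

module GeneralizedDihedral {n : ℕ} (_∙_ : Fin n → Fin n → Fin n) (ε : Fin n) (_⁻¹ : Fin n → Fin n)
                           (isAbelianGroup : IsAbelianGroup _≡_ _∙_ ε _⁻¹) where

  open DA _∙_ ε _⁻¹
  open AbelianGroupSquares isAbelianGroup
  open IsAbelianGroup isAbelianGroup using (identityˡ; identityʳ; inverseˡ; inverseʳ; assoc)

  isSquare? : ∀ z → Dec (IsSquare z)
  isSquare? z = any? (λ c → z ≟ᶠ (c ∙ c))

  rotation-fixing-coset⇒ε : ∀ {a} k → FixesCoset (ι a) k → a ≡ ε
  rotation-fixing-coset⇒ε (false , c) (_ , inj₁ refl , eq) =
    identityˡ-unique _ c (trans (cong proj₂ eq) (identityʳ c))
  rotation-fixing-coset⇒ε (true , c) (_ , inj₁ refl , eq) =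
    ⁻¹≡ε⇒≡ε (identityˡ-unique _ c (trans (cong proj₂ eq) (identityʳ c)))
  rotation-fixing-coset⇒ε (false , _) (_ , inj₂ refl , ())
  rotation-fixing-coset⇒ε (true , _) (_ , inj₂ refl , ())

  reflection-fixing-coset⇒isSquare : ∀ {b} k → FixesCoset (true , b) k → IsSquare b
  reflection-fixing-coset⇒isSquare (false , _) (_ , inj₁ refl , ())
  reflection-fixing-coset⇒isSquare (true , _) (_ , inj₁ refl , ())
  reflection-fixing-coset⇒isSquare (false , c) (_ , inj₂ refl , eq) =
    ∙c≡c⁻¹⇒isSquare (trans (cong proj₂ eq) (identityʳ (c ⁻¹)))
  reflection-fixing-coset⇒isSquare (true , c) (_ , inj₂ refl , eq) =
    isSquare-⁻¹ (∙c≡c⁻¹⇒isSquare (trans (cong proj₂ eq) (identityʳ (c ⁻¹))))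

  square-reflection-fixing-coset : ∀ c → FixesCoset (true , c ∙ c) (ι (c ⁻¹))
  square-reflection-fixing-coset c = xg , inj₂ refl , cong (true ,_) (begin
    (c ∙ c) ∙ (c ⁻¹) ≡⟨ assoc c c (c ⁻¹) ⟩
    c ∙ (c ∙ (c ⁻¹)) ≡⟨ cong (c ∙_) (inverseʳ c) ⟩
    c ∙ ε            ≡⟨ cong (_∙ ε) (sym (⁻¹-involutive c)) ⟩
    ((c ⁻¹) ⁻¹) ∙ ε  ∎)
    where open ≡-Reasoning

  ι-derangement : ∀ {a} → a ≢ ε → Der (ι a)
  ι-derangement a≢ε k = a≢ε ∘ rotation-fixing-coset⇒ε k

  reflection-derangement : ∀ {b} → ¬ IsSquare b → Der (true , b)
  reflection-derangement ¬sq k = ¬sq ∘ reflection-fixing-coset⇒isSquare k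

  e-not-derangement : ¬ Der e
  e-not-derangement der = der e (e , inj₁ refl , refl)

  square-reflection-not-derangement : ∀ {b} → IsSquare b → ¬ Der (true , b)
  square-reflection-not-derangement (c , refl) der = der _ (square-reflection-fixing-coset c)

  derangement-ι⇒≢ε : ∀ {a} → Der (ι a) → a ≢ ε
  derangement-ι⇒≢ε der refl = e-not-derangement der

  not-derangement-ι⇒ε : ∀ {z} → ¬ Der (ι z) → z ≡ ε
  not-derangement-ι⇒ε {z} ¬der = decidable-stable (z ≟ᶠ ε) (¬der ∘ ι-derangement)

  not-derangement-reflection⇒isSquare : ∀ {z} → ¬ Der (true , z) → IsSquare z
  not-derangement-reflection⇒isSquare {z} ¬der =
    decidable-stable (isSquare? z) (¬der ∘ reflection-derangement)

  ι-hasOrder3 : ∀ {a} → a ≢ ε → cube a ≡ ε → HasOrder (ι a) 3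
  ι-hasOrder3 {a} a≢ε cube≡ε = s≤s z≤n , cong (false ,_) cube≡ε , lower-powers
    where
      lower-powers : ∀ m → 0 < m → m < 3 → ι a ^ m ≢ e
      lower-powers 1 _ _ a¹≡e = a≢ε (trans (sym (identityʳ a)) (cong proj₂ a¹≡e))
      lower-powers 2 _ _ a²≡e =
        a≢ε (trans (sym (identityʳ a)) (trans (cong (a ∙_) (sym (cong proj₂ a²≡e))) cube≡ε))
      lower-powers (suc (suc (suc _))) _ (s≤s (s≤s (s≤s ())))

  ι-hasOrder3⇒cube≡ε : ∀ {a} → HasOrder (ι a) 3 → cube a ≡ ε
  ι-hasOrder3⇒cube≡ε (_ , a³≡e , _) = cong proj₂ a³≡e

  nonadjacent : ∀ {d g} → ¬ InS d g → ¬ Der g ⊎ g ≡ d ⊎ g ≡ inv d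
  nonadjacent {d} {g} ¬adj with ≡-dec _≟ᵇ_ _≟ᶠ_ g d | ≡-dec _≟ᵇ_ _≟ᶠ_ g (inv d)
  ... | yes g≡d | _ = inj₂ (inj₁ g≡d)
  ... | no _ | yes g≡d⁻¹ = inj₂ (inj₂ g≡d⁻¹)
  ... | no g≢d | no g≢d⁻¹ = inj₁ (λ der → ¬adj (der , g≢d , g≢d⁻¹))

  ι-nonadjacent-ι⇒near : ∀ {a z} → ¬ InS (ι a) (ι z) → Near a z
  ι-nonadjacent-ι⇒near ¬adj with nonadjacent ¬adj
  ... | inj₁ ¬der = inj₁ (not-derangement-ι⇒ε ¬der)
  ... | inj₂ (inj₁ refl) = inj₂ (inj₁ refl)
  ... | inj₂ (inj₂ refl) = inj₂ (inj₂ refl)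

  ι-nonadjacent-reflection⇒isSquare : ∀ {a z} → ¬ InS (ι a) (true , z) → IsSquare z
  ι-nonadjacent-reflection⇒isSquare ¬adj with nonadjacent ¬adj
  ... | inj₁ ¬der = not-derangement-reflection⇒isSquare ¬der
  ... | inj₂ (inj₁ ())
  ... | inj₂ (inj₂ ())

  reflection-nonadjacent-ι⇒ε : ∀ {b z} → ¬ InS (true , b) (ι z) → z ≡ ε
  reflection-nonadjacent-ι⇒ε ¬adj with nonadjacent ¬adj
  ... | inj₁ ¬der = not-derangement-ι⇒ε ¬der
  ... | inj₂ (inj₁ ())
  ... | inj₂ (inj₂ ())

  near⇒nonadjacent : ∀ {a z} → Near a z → ¬ InS (ι a) (ι z)
  near⇒nonadjacent (inj₁ refl) (der , _) = e-not-derangement der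
  near⇒nonadjacent (inj₂ (inj₁ refl)) (_ , ≢a , _) = ≢a refl
  near⇒nonadjacent (inj₂ (inj₂ refl)) (_ , _ , ≢a⁻¹) = ≢a⁻¹ refl

  isSquare⇒nonadjacent : ∀ {d z} → IsSquare z → ¬ InS d (true , z)
  isSquare⇒nonadjacent sq (der , _) = square-reflection-not-derangement sq der

  inv-·-same-coset : ∀ b u v → inv (b , u) · (b , v) ≡ ι (u \\ v)
  inv-·-same-coset false u v = refl
  inv-·-same-coset true u v = refl

  part : Bool → List G → List (Fin n)
  part b [] = []
  part b ((b′ , u) ∷ L) with b′ ≟ᵇ b
  ... | yes _ = u ∷ part b L
  ... | no _ = part b L

  ∈-part : ∀ b L {u} → u ∈ part b L → (b , u) ∈ L
  ∈-part b ((b′ , v) ∷ L) u∈ with b′ ≟ᵇ b | u∈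
  ... | yes refl | ∈₀ = ∈₀
  ... | yes refl | there u∈′ = there (∈-part b L u∈′)
  ... | no _ | u∈′ = there (∈-part b L u∈′)

  part-unique : ∀ b {L} → Unique L → Unique (part b L)
  part-unique b {[]} [] = []
  part-unique b {(b′ , u) ∷ L} (u∉ ∷ uniq) with b′ ≟ᵇ b
  ... | yes refl = All.tabulate (λ v∈ → All.lookup u∉ (∈-part b L v∈) ∘ cong (b ,_)) ∷ part-unique b uniq
  ... | no _ = part-unique b uniq

  length-parts : ∀ L → length L ≡ length (part false L) + length (part true L)
  length-parts [] = refl
  length-parts ((false , _) ∷ L) = cong suc (length-parts L)
  length-parts ((true , _) ∷ L) = trans (cong suc (length-parts L)) (sym (+-suc _ _))

  length-by-parts : ∀ L {r f} → length (part false L) ≤ r → length (part true L) ≤ f → length L ≤ r + f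
  length-by-parts L r≤ f≤ = subst (_≤ _) (sym (length-parts L)) (+-mono-≤ r≤ f≤)

  part-diffs : ∀ {d L} {T : Fin n → Set} → Independent (InS d) L → ∀ b →
    (∀ {z} → ¬ InS d (ι z) → T z) → Diffs T (part b L)
  part-diffs {d} {L} (_ , nonadj) b T-of-nonadjacent u∈ v∈ = T-of-nonadjacent
    (subst (¬_ ∘ InS d) (inv-·-same-coset b _ _) (nonadj (∈-part b L u∈) (∈-part b L v∈)))

  reflection-α≤2 : ∀ {b L} → Independent (InS (true , b)) L → length L ≤ 2
  reflection-α≤2 {L = L} (uniq , nonadj) = length-by-parts L
    (length≤1 (part-unique false uniq) (part-diffs (uniq , nonadj) false reflection-nonadjacent-ι⇒ε))
    (length≤1 (part-unique true uniq) (part-diffs (uniq , nonadj) true reflection-nonadjacent-ι⇒ε))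

  module _ {a L} (independent : Independent (InS (ι a)) L) where

    private
      R = part false L
      F = part true L

      uniqueR : Unique R
      uniqueR = part-unique false (proj₁ independent)

      uniqueF : Unique F
      uniqueF = part-unique true (proj₁ independent)

      nearR : Diffs (Near a) R
      nearR = part-diffs independent false ι-nonadjacent-ι⇒near

      nearF : Diffs (Near a) F
      nearF = part-diffs independent true ι-nonadjacent-ι⇒near

      cross-square : ∀ {u v} → v ∈ F → u ∈ R → IsSquare (v ∙ u)
      cross-square v∈ u∈ =
        ι-nonadjacent-reflection⇒isSquare (proj₂ independent (∈-part true L v∈) (∈-part false L u∈))

    ι-α≤6 : length L ≤ 6
    ι-α≤6 = length-by-parts L (length≤3 uniqueR nearR) (length≤3 uniqueF nearF)

    ι-α≤4 : a ≢ ε → cube a ≢ ε → length L ≤ 4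
    ι-α≤4 a≢ε cube≢ε = length-by-parts L (length≤2 a≢ε cube≢ε uniqueR nearR) (length≤2 a≢ε cube≢ε uniqueF nearF)

    -- Two points of one coset and one of the other would make a step of Near a a square.
    ι-α≤2 : a ≢ ε → cube a ≢ ε → ¬ IsSquare a → length L ≤ 2
    ι-α≤2 a≢ε cube≢ε ¬sq = subst (_≤ 2) (sym (length-parts L))
      (length+length≤2 R F (length≤2 a≢ε cube≢ε uniqueR nearR) (length≤2 a≢ε cube≢ε uniqueF nearF)
        (λ {v} v∈ → length≤1 uniqueR (λ {u₁} {u₂} u₁∈ u₂∈ → near-isSquare ¬sq (nearR u₁∈ u₂∈)
          (subst IsSquare (\\-cancelˡ v u₁ u₂) (\\-isSquare (cross-square v∈ u₁∈) (cross-square v∈ u₂∈)))))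
        (λ {u} u∈ → length≤1 uniqueF (λ {v₁} {v₂} v₁∈ v₂∈ → near-isSquare ¬sq (nearF v₁∈ v₂∈)
          (subst IsSquare (\\-cancelʳ u v₁ v₂) (\\-isSquare (cross-square v₁∈ u∈) (cross-square v₂∈ u∈))))))

  inv-·-self : ∀ g → inv g · g ≡ e
  inv-·-self (b , u) = trans (inv-·-same-coset b u u) (cong ι (inverseˡ u))

  inv-e-· : ∀ g → inv e · g ≡ g
  inv-e-· (false , u) = cong ι (ε\\x≡x u)
  inv-e-· (true , u) = cong (true ,_) (trans (cong (_∙ u) (⁻¹-involutive ε)) (identityˡ u))

  ·-e : ∀ g → g · e ≡ g
  ·-e (false , u) = cong ι (identityʳ u)
  ·-e (true , u) = cong (true ,_) (identityʳ u)

  pair-independent : ∀ {d} → Der d → Independent (InS d) (e ∷ d ∷ [])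
  pair-independent {d} der = ((λ e≡d → e-not-derangement (subst Der (sym e≡d) der)) ∷ []) ∷ [] ∷ [] , nonadj
    where
      self-nonadjacent : ∀ g → ¬ InS d (inv g · g)
      self-nonadjacent g (der′ , _) = e-not-derangement (subst Der (inv-·-self g) der′)

      nonadj : ∀ {g h} → g ∈ e ∷ d ∷ [] → h ∈ e ∷ d ∷ [] → ¬ InS d (inv g · h)
      nonadj ∈₀ ∈₀ = self-nonadjacent e
      nonadj ∈₁ ∈₁ = self-nonadjacent d
      nonadj ∈₀ ∈₁ (_ , ≢d , _) = ≢d (inv-e-· d)
      nonadj ∈₁ ∈₀ (_ , _ , ≢d⁻¹) = ≢d⁻¹ (·-e (inv d))

  doubled : List (Fin n) → List G
  doubled R = map ι R ++ map (true ,_) R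

  ∈-doubled⁻ : ∀ R {g} → g ∈ doubled R → Σ Bool λ b → ∃ λ u → u ∈ R × g ≡ (b , u)
  ∈-doubled⁻ R g∈ with ∈-++⁻ (map ι R) g∈
  ... | inj₁ g∈ι with ∈-map⁻ ι g∈ι
  ...   | u , u∈ , refl = false , u , u∈ , refl
  ∈-doubled⁻ R g∈ | inj₂ g∈x with ∈-map⁻ (true ,_) g∈x
  ...   | u , u∈ , refl = true , u , u∈ , refl

  doubled-unique : ∀ {R} → Unique R → Unique (doubled R)
  doubled-unique {R} uniq = ++⁺ (map⁺ (cong proj₂) uniq) (map⁺ (cong proj₂) uniq) cosets-disjoint
    where
      cosets-disjoint : ∀ {g} → ¬ (g ∈ map ι R × g ∈ map (true ,_) R)
      cosets-disjoint (g∈ι , g∈x) with ∈-map⁻ ι g∈ι | ∈-map⁻ (true ,_) g∈x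
      ... | _ , _ , refl | _ , _ , ()

  doubled-independent : ∀ {a R} → Unique R → All IsSquare R → Diffs (Near a) R →
    Independent (InS (ι a)) (doubled R)
  doubled-independent {a} {R} uniq squares near = doubled-unique uniq , nonadj
    where
      nonadj : ∀ {g h} → g ∈ doubled R → h ∈ doubled R → ¬ InS (ι a) (inv g · h)
      nonadj g∈ h∈ with ∈-doubled⁻ R g∈ | ∈-doubled⁻ R h∈
      ... | false , _ , u∈ , refl | false , _ , v∈ , refl = near⇒nonadjacent (near u∈ v∈)
      ... | true , _ , u∈ , refl | true , _ , v∈ , refl = near⇒nonadjacent (near u∈ v∈)
      ... | false , _ , u∈ , refl | true , _ , v∈ , refl = isSquare⇒nonadjacent
        (∙-isSquare (⁻¹-isSquare (⁻¹-isSquare (All.lookup squares u∈))) (All.lookup squares v∈))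
      ... | true , _ , u∈ , refl | false , _ , v∈ , refl = isSquare⇒nonadjacent
        (∙-isSquare (All.lookup squares u∈) (All.lookup squares v∈))

  α-order3 : ∀ {a} → a ≢ ε → cube a ≡ ε → IsIndependenceNumber (InS (ι a)) 6
  α-order3 {a} a≢ε cube≡ε =
    (doubled (ε ∷ a ∷ a ⁻¹ ∷ []) , doubled-independent distinct squares near , refl) , λ _ → ι-α≤6
    where
      a∙a≡a⁻¹ = cube≡ε⇒x∙x≡x⁻¹ cube≡ε
      distinct : Unique (ε ∷ a ∷ a ⁻¹ ∷ [])
      distinct = ((a≢ε ∘ sym) ∷ (a≢ε ∘ ⁻¹≡ε⇒≡ε ∘ sym) ∷ [])
               ∷ ((λ a≡a⁻¹ → a≢ε (identityʳ-unique a a (trans a∙a≡a⁻¹ (sym a≡a⁻¹)))) ∷ [])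
               ∷ [] ∷ []
      squares : All IsSquare (ε ∷ a ∷ a ⁻¹ ∷ [])
      squares = ε-isSquare ∷ (a ⁻¹ , sym (x∙x≡x⁻¹⇒x⁻¹∙x⁻¹≡x a∙a≡a⁻¹)) ∷ (a , sym a∙a≡a⁻¹) ∷ []
      near : Diffs (Near a) (ε ∷ a ∷ a ⁻¹ ∷ [])
      near = diffs-from-pairs (inj₁ refl) near-⁻¹
        ((inj₂ (inj₁ (ε\\x≡x a)) ∷ inj₂ (inj₂ (ε\\x≡x (a ⁻¹))) ∷ [])
        ∷ (inj₂ (inj₁ (x∙x≡x⁻¹⇒x⁻¹∙x⁻¹≡x a∙a≡a⁻¹)) ∷ [])
        ∷ [] ∷ [])

  α-square : ∀ {a} → a ≢ ε → cube a ≢ ε → IsSquare a → IsIndependenceNumber (InS (ι a)) 4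
  α-square {a} a≢ε cube≢ε sq =
    (doubled (ε ∷ a ∷ []) , doubled-independent distinct (ε-isSquare ∷ sq ∷ []) near , refl) ,
    λ _ independent → ι-α≤4 independent a≢ε cube≢ε
    where
      distinct : Unique (ε ∷ a ∷ [])
      distinct = ((a≢ε ∘ sym) ∷ []) ∷ [] ∷ []
      near : Diffs (Near a) (ε ∷ a ∷ [])
      near = diffs-from-pairs (inj₁ refl) near-⁻¹ ((inj₂ (inj₁ (ε\\x≡x a)) ∷ []) ∷ [] ∷ [])

  α-nonsquare : ∀ {a} → a ≢ ε → cube a ≢ ε → ¬ IsSquare a → IsIndependenceNumber (InS (ι a)) 2
  α-nonsquare a≢ε cube≢ε ¬sq =
    (_ , pair-independent (ι-derangement a≢ε) , refl) , λ _ independent → ι-α≤2 independent a≢ε cube≢ε ¬sq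

  α-reflection : ∀ {b} → ¬ IsSquare b → IsIndependenceNumber (InS (true , b)) 2
  α-reflection ¬sq = (_ , pair-independent (reflection-derangement ¬sq) , refl) , λ _ → reflection-α≤2

  InAOfOrder3 : G → Set
  InAOfOrder3 d = proj₁ d ≡ false × HasOrder d 3

  SquareNotOfOrder3 : G → Set
  SquareNotOfOrder3 d = ¬ HasOrder d 3 × Σ (Fin n) λ c → d ≡ ι c · ι c

  Classified : G → ℕ → Set
  Classified d k = IsIndependenceNumber (InS d) k × (k ≡ 2 ⊎ k ≡ 4 ⊎ k ≡ 6) ×
                   ((k ≡ 6) ⇔ InAOfOrder3 d) × ((k ≡ 4) ⇔ SquareNotOfOrder3 d)

  rotation-classified : ∀ {a} → a ≢ ε → Σ ℕ (Classified (ι a))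
  rotation-classified {a} a≢ε with cube a ≟ᶠ ε | isSquare? a
  ... | yes cube≡ε | _ = 6 , α-order3 a≢ε cube≡ε , inj₂ (inj₂ refl) ,
    ⇔-witnessed (refl , ι-hasOrder3 a≢ε cube≡ε) ,
    ⇔-refuted (λ ()) (λ (¬order3 , _) → ¬order3 (ι-hasOrder3 a≢ε cube≡ε))
  ... | no cube≢ε | yes (c , a≡c²) = 4 , α-square a≢ε cube≢ε (c , a≡c²) , inj₂ (inj₁ refl) ,
    ⇔-refuted (λ ()) (cube≢ε ∘ ι-hasOrder3⇒cube≡ε ∘ proj₂) ,
    ⇔-witnessed ((cube≢ε ∘ ι-hasOrder3⇒cube≡ε) , c , cong ι a≡c²)
  ... | no cube≢ε | no ¬sq = 2 , α-nonsquare a≢ε cube≢ε ¬sq , inj₁ refl ,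
    ⇔-refuted (λ ()) (cube≢ε ∘ ι-hasOrder3⇒cube≡ε ∘ proj₂) ,
    ⇔-refuted (λ ()) (λ (_ , c , a≡c²) → ¬sq (c , cong proj₂ a≡c²))

  classified : ∀ d → Der d → Σ ℕ (Classified d)
  classified (false , a) der = rotation-classified (derangement-ι⇒≢ε der)
  classified (true , b) der = 2 , α-reflection (λ sq → square-reflection-not-derangement sq der) , inj₁ refl ,
    ⇔-refuted (λ ()) (λ ()) , ⇔-refuted (λ ()) (λ ())

proposition4p4 : (n : ℕ) → 2 ∣ n →
    (_∙_ : Fin n → Fin n → Fin n) (ε : Fin n) (_⁻¹ : Fin n → Fin n) →
    IsAbelianGroup _≡_ _∙_ ε _⁻¹ →
    ¬ (∀ a → a ∙ a ≡ ε) →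
    let open DA _∙_ ε _⁻¹ in
    (d : G) → Der d →
    Σ ℕ λ k → IsIndependenceNumber (InS d) k ×
      ((k ≡ 2) ⊎ (k ≡ 4) ⊎ (k ≡ 6)) ×
      ((k ≡ 6) ⇔ ((proj₁ d ≡ false) × HasOrder d 3)) ×
      ((k ≡ 4) ⇔ (¬ HasOrder d 3 × Σ (Fin n) λ a → d ≡ ι a · ι a)) ×
      ((k ≡ 2) ⇔ (¬ ((proj₁ d ≡ false) × HasOrder d 3) ×
                  ¬ (¬ HasOrder d 3 × Σ (Fin n) λ a → d ≡ ι a · ι a)))
proposition4p4 n _ _∙_ ε _⁻¹ isAbelianGroup _ d der =
  let k , α , range , six , four = classified d der
  in k , α , range , six , four , ≡2⇔neither range six four
  where open GeneralizedDihedral _∙_ ε _⁻¹ isAbelianGroup
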